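{- Let $t$ be an $\mathrm{SL}_2$-tiling and let $i<j<k<\ell$ be integers. Then $c_{ik}c_{j\ell}=c_{ij}c_{k\ell}+c_{i\ell}c_{jk}$ and $d_{ik}d_{j\ell}=d_{ij}d_{k\ell}+d_{i\ell}d_{jk}$.
   Context: An $\mathrm{SL}_2$-tiling is a map $t:\mathbb{Z}\times\mathbb{Z}\to\{1,2,3,\dots\}$, $(i,j)\mapsto t_{ij}$, with $t_{ij}t_{i+1,j+1}-t_{i,j+1}t_{i+1,j}=1$ for all $i,j$. For integers $i<j$ define $c_{ij}=t_{ia}t_{j,a+1}-t_{i,a+1}t_{ja}$ and $d_{ij}=t_{ai}t_{a+1,j}-t_{aj}t_{a+1,i}$, where $a$ is any integer; these values do not depend on the choice of $a$. -}

module Defs where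

open import Data.Integer using (ℤ; +_; _+_; _-_; _*_; _<_; +<+)
open import Data.Nat using (ℕ)
open import Relation.Binary.PropositionalEquality using (_≡_)

record SL2Tiling : Set where
  field
    t        : ℤ → ℤ → ℤ
    positive : ∀ i j → + 0 < t i j
    unimod   : ∀ i j → t i j * t (i + + 1) (j + + 1) - t i (j + + 1) * t (i + + 1) j ≡ + 1

open SL2Tiling public

-- c_{ij} = t_{ia} t_{j,a+1} - t_{i,a+1} t_{ja}, computed with the choice a = 0
-- (the value is independent of a, as stated in the paper).
c : SL2Tiling → ℤ → ℤ → ℤ
c T i j = t T i a * t T j (a + + 1) - t T i (a + + 1) * t T j a
  where a = + 0

d : SL2Tiling → ℤ → ℤ → ℤ
d T i j = t T a i * t T (a + + 1) j - t T a j * t T (a + + 1) i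
  where a = + 0

module Submission where

-- The quantities c_{ij} and d_{ij} are 2×2 minors of a 2 × ℤ matrix:
-- c_{ij} is the minor on rows i, j of the two columns 0 and 1 of the tiling,
-- d_{ij} the minor on columns i, j of the two rows 0 and 1.  The identity to
-- prove is therefore the three-term Plücker relation
--   Δ_{ik} Δ_{jl} = Δ_{ij} Δ_{kl} + Δ_{il} Δ_{jk}
-- for the minors Δ_{pq} = x_p y_q - x_q y_p of any family of vectors
-- (x_p, y_p) in ℤ², which holds identically.

open import Defs
open import Data.Integer using (ℤ; +_; _+_; _-_; _*_; _<_)
open import Data.Integer.Properties using (*-comm)
open import Data.Integer.Solver using (module +-*-Solver)
open import Data.Product using (_×_; _,_)
open import Relation.Binary.PropositionalEquality using (_≡_; refl; cong)

open +-*-Solver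

minor : {I : Set} → (I → ℤ) → (I → ℤ) → I → I → ℤ
minor x y p q = x p * y q - x q * y p

plücker-ℤ : ∀ xi yi xj yj xk yk xl yl →
  (xi * yk - xk * yi) * (xj * yl - xl * yj) ≡
  (xi * yj - xj * yi) * (xk * yl - xl * yk) + (xi * yl - xl * yi) * (xj * yk - xk * yj)
plücker-ℤ = solve 8 (λ xi yi xj yj xk yk xl yl →
  (xi :* yk :- xk :* yi) :* (xj :* yl :- xl :* yj) :=
  (xi :* yj :- xj :* yi) :* (xk :* yl :- xl :* yk) :+ (xi :* yl :- xl :* yi) :* (xj :* yk :- xk :* yj)) refl

plücker : {I : Set} (x y : I → ℤ) (i j k l : I) →
  minor x y i k * minor x y j l ≡ minor x y i j * minor x y k l + minor x y i l * minor x y j k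
plücker x y i j k l = plücker-ℤ (x i) (y i) (x j) (y j) (x k) (y k) (x l) (y l)

c-minor : (T : SL2Tiling) (p q : ℤ) →
  c T p q ≡ minor (λ r → t T r (+ 0)) (λ r → t T r (+ 1)) p q
c-minor T p q = cong (λ z → t T p (+ 0) * t T q (+ 1) - z) (*-comm (t T p (+ 1)) (t T q (+ 0)))

d-minor : (T : SL2Tiling) (p q : ℤ) →
  d T p q ≡ minor (t T (+ 0)) (t T (+ 1)) p q
d-minor T p q = refl

plücker-via : {I : Set} (f : I → I → ℤ) (x y : I → ℤ) →
  (∀ p q → f p q ≡ minor x y p q) → (i j k l : I) →
  f i k * f j l ≡ f i j * f k l + f i l * f j k
plücker-via f x y f≡Δ i j k l
  rewrite f≡Δ i k | f≡Δ j l | f≡Δ i j | f≡Δ k l | f≡Δ i l | f≡Δ j k =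
  plücker x y i j k l

proposition5p4 : (T : SL2Tiling) (i j k l : ℤ) → i < j → j < k → k < l →
    (c T i k * c T j l ≡ c T i j * c T k l + c T i l * c T j k)
    × (d T i k * d T j l ≡ d T i j * d T k l + d T i l * d T j k)
proposition5p4 T i j k l _ _ _ =
  plücker-via (c T) (λ r → t T r (+ 0)) (λ r → t T r (+ 1)) (c-minor T) i j k l
  , plücker-via (d T) (t T (+ 0)) (t T (+ 1)) (d-minor T) i j k l
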